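{- If $|X|=4p-3$, then (a) $-1+(p, X)-(2p, X)+(3p, X)\equiv 0 \pmod p$, and (b) $(p-1, X)-(2p-1, X)+(3p-1, X)\equiv 0 \pmod p$.
   Context: Let $p$ be an odd prime and let $X$ be a finite set of lattice points in the Euclidean plane. For a positive integer $n$, $(n, X)$ denotes the number of $n$-element subsets of $X$ the sum of whose elements (taken coordinatewise) is divisible by $p$, i.e. is $\equiv (0,0) \pmod p$. -}

module Defs where

open import Data.Nat using (ℕ; zero; suc)
open import Data.Integer using (ℤ; +_; _+_; ∣_∣)
open import Data.Integer.Divisibility using (_∣_)
open import Data.Nat.Divisibility using (_∣?_)
open import Data.Product using (_×_; _,_)
open import Data.List using (List; []; _∷_; _++_; map; length; foldr)
open import Data.Bool using (Bool; true; false; _∧_; if_then_else_)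
open import Data.Nat using (_≡ᵇ_)
open import Relation.Nullary using (Dec; yes; no)

Point : Set
Point = ℤ × ℤ

sumPts : List Point → Point
sumPts = foldr (λ { (a , b) (c , d) → (a + c , b + d) }) (+ 0 , + 0)

-- All sublists of a list (subsets by position). For a list of
-- pairwise distinct points these are exactly its subsets.
sublists : {A : Set} → List A → List (List A)
sublists [] = [] ∷ []
sublists (x ∷ xs) = sublists xs ++ map (x ∷_) (sublists xs)

-- Decides whether the sum of the points is ≡ (0,0) mod p, i.e. p divides
-- both coordinates (Data.Integer divisibility is |p| ∣ |a| on ℕ).
sumDivisible? : (p : ℕ) → (s : List Point) → Bool
sumDivisible? p s with sumPts s
... | (a , b) with p ∣? ∣ a ∣ | p ∣? ∣ b ∣
... | yes _ | yes _ = true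
... | _ | _ = false

count : {A : Set} → (A → Bool) → List A → ℕ
count f [] = 0
count f (x ∷ xs) = if f x then suc (count f xs) else count f xs

numSubsets : (p n : ℕ) → List Point → ℕ
numSubsets p n X =
  count (λ s → (length s ≡ᵇ n) ∧ sumDivisible? p s) (sublists X)

-- The Chevalley–Warning argument. Write q = p - 1 and χ t = 1 - t^q, so that χ t ≡ [p ∣ t]
-- (mod p) by Fermat's little theorem. For c ∈ {0, 1} put
--   Φ s = χ (c + |s|) · χ (Σ x-coordinates of s) · χ (Σ y-coordinates of s)
-- on sublists s of X. Each argument of χ grows by a fixed amount when a point is added to s,
-- so Φ has degree ≤ 3q in the finite-difference sense: all its (3q+1)-fold differences vanish.
-- The alternating sum Σ_{s ⊆ X} (-1)^|s| Φ s is an |X|-fold finite difference, hence is 0 as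
-- |X| = 4p - 3 > 3q. Modulo p, since c + |s| < 4p, the term (-1)^(c+|s|) Φ s is (-1)^j when
-- c + |s| = jp and the sum of s is ≡ (0,0), and 0 otherwise; so Σ_{j<4} (-1)^j (jp - c, X) ≡ 0
-- (reading (-1, X) as 0). The case c = 0 is (a), the empty set accounting for the -1, and
-- c = 1 is (b).
module Submission where

open import Defs

-- Scoped so that the ℤ operators opened here do not clash with the ℕ ones opened for corollary5.
module _ where

  open import Data.Bool using (Bool; true; false; _∧_; if_then_else_)
  open import Data.Fin as Fin using (Fin; toℕ; fromℕ; inject₁)
  open import Data.Fin.Properties using (toℕ-fromℕ; toℕ-inject₁; toℕ<n)
  open import Data.Integer as ℤ using (ℤ; +_; 0ℤ; 1ℤ; -1ℤ; _+_; _-_; _*_; -_; _^_)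
  open import Data.Integer.DivMod using (_/_; _%_; a≡a%n+[a/n]*n)
  open import Data.Integer.Divisibility.Signed
    using (divides; ∣m∣n⇒∣m+n; ∣m⇒∣-m; ∣m⇒∣m*n; ∣n⇒∣m*n; ∣ᵤ⇒∣; ∣⇒∣ᵤ)
    renaming (_∣_ to _∣ℤ_)
  import Data.Integer.Properties as ℤ
  open import Algebra.Definitions.RawMonoid ℤ.+-0-rawMonoid using (sum; _×_)
  import Algebra.Definitions.RawSemiring ℤ.+-*-rawSemiring as Semiring
  open import Algebra.Properties.CommutativeSemiring.Binomial ℤ.+-*-commutativeSemiring
    using (theorem)
  open import Algebra.Properties.Monoid.Sum ℤ.+-0-monoid using (sum-init-last)
  open import Data.Integer.Tactic.RingSolver using (solve-∀)
  open import Data.List using (List; []; _∷_; _++_; map; length; upTo)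
  open import Data.List.Properties using (map-applyUpTo)
  open import Data.List.Relation.Unary.All as All using (All; []; _∷_)
  import Data.List.Relation.Unary.All.Properties as All
  open import Data.Nat as ℕ using (ℕ; zero; suc; _<_; _≤_; z≤n; s≤s; _!; _≡ᵇ_; NonZero)
  open import Data.Nat.Combinatorics using (_C_; nCn≡1; nCk≡n!/k![n-k]!; k![n∸k]!∣n!)
  open import Data.Nat.Divisibility as ℕ∣ using (_∤_; ∣⇒≤; ∣1⇒≡1; m∣m*n)
    renaming (_∣_ to _∣ℕ_)
  open import Data.Nat.DivMod using (m/n*n≡m; m%n<n; m≡m%n+[m/n]*n)
  open import Data.Nat.Primality
    using (Prime; euclidsLemma; prime⇒irreducible; prime⇒nonZero; prime⇒nonTrivial)
  import Data.Nat.Properties as ℕ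
  open import Data.Product using (proj₁; proj₂; _,_)
  open import Data.Sum using (_⊎_; inj₁; inj₂; [_,_]′)
  open import Function using (_∘_; id)
  open import Level using (0ℓ)
  open import Relation.Binary.Bundles using (Setoid)
  open import Relation.Binary.PropositionalEquality
    using (_≡_; _≢_; refl; sym; trans; cong; cong₂; subst; subst₂; module ≡-Reasoning)
  import Relation.Binary.Reasoning.Setoid as SetoidReasoning
  open import Relation.Nullary using (contradiction; yes; no; does)
  open import Relation.Nullary.Decidable using (dec-true; dec-false)

  private
    variable
      A B D : Set
      d e : ℕ
      F G : List A → ℤ

  ∑ : List B → (B → ℤ) → ℤ
  ∑ []       f = 0ℤ
  ∑ (b ∷ bs) f = f b + ∑ bs f

  indicator : Bool → ℤ
  indicator b = if b then 1ℤ else 0ℤ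

  ∑-cong : ∀ (S : List B) {f g} → (∀ b → f b ≡ g b) → ∑ S f ≡ ∑ S g
  ∑-cong []      f≗g = refl
  ∑-cong (b ∷ S) f≗g = cong₂ _+_ (f≗g b) (∑-cong S f≗g)

  ∑-zero : ∀ (S : List B) → ∑ S (λ _ → 0ℤ) ≡ 0ℤ
  ∑-zero []      = refl
  ∑-zero (b ∷ S) = trans (ℤ.+-identityˡ _) (∑-zero S)

  ∑-++ : ∀ (S T : List B) f → ∑ (S ++ T) f ≡ ∑ S f + ∑ T f
  ∑-++ []      T f = sym (ℤ.+-identityˡ (∑ T f))
  ∑-++ (b ∷ S) T f = trans (cong (_+_ (f b)) (∑-++ S T f)) (sym (ℤ.+-assoc (f b) _ _))

  ∑-map : ∀ (g : D → B) (S : List D) f → ∑ (map g S) f ≡ ∑ S (f ∘ g)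
  ∑-map g []      f = refl
  ∑-map g (c ∷ S) f = cong (_+_ (f (g c))) (∑-map g S f)

  ∑-+ : ∀ (S : List B) f g → ∑ S (λ b → f b + g b) ≡ ∑ S f + ∑ S g
  ∑-+ []      f g = refl
  ∑-+ (b ∷ S) f g = trans (cong (_+_ (f b + g b)) (∑-+ S f g)) (interchange (f b) (g b) _ _)
    where
    interchange : ∀ a b c d → a + b + (c + d) ≡ a + c + (b + d)
    interchange = solve-∀

  ∑-* : ∀ (S : List B) a f → ∑ S (λ b → a * f b) ≡ a * ∑ S f
  ∑-* []      a f = sym (ℤ.*-zeroʳ a)
  ∑-* (b ∷ S) a f = trans (cong (_+_ (a * f b)) (∑-* S a f)) (sym (ℤ.*-distribˡ-+ a (f b) _))

  ∑-*ʳ : ∀ (S : List B) f a → ∑ S (λ b → f b * a) ≡ ∑ S f * a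
  ∑-*ʳ []      f a = sym (ℤ.*-zeroˡ a)
  ∑-*ʳ (b ∷ S) f a = trans (cong (_+_ (f b * a)) (∑-*ʳ S f a)) (sym (ℤ.*-distribʳ-+ a (f b) _))

  ∑-comm : ∀ (S : List B) (T : List D) (f : B → D → ℤ) →
           ∑ S (λ b → ∑ T (f b)) ≡ ∑ T (λ c → ∑ S (λ b → f b c))
  ∑-comm []      T f = sym (∑-zero T)
  ∑-comm (b ∷ S) T f = trans (cong (_+_ (∑ T (f b))) (∑-comm S T f)) (sym (∑-+ T (f b) _))

  ∑-count : ∀ (P : B → Bool) S → ∑ S (indicator ∘ P) ≡ + count P S
  ∑-count P [] = refl
  ∑-count P (b ∷ S) with P b
  ... | true  = cong (_+_ 1ℤ) (∑-count P S)
  ... | false = trans (ℤ.+-identityˡ _) (∑-count P S)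

  count-false : ∀ (S : List B) → count (λ _ → false) S ≡ 0
  count-false []      = refl
  count-false (b ∷ S) = count-false S

  indicator-∧ : ∀ a b → indicator (a ∧ b) ≡ indicator a * indicator b
  indicator-∧ true  b = sym (ℤ.*-identityˡ (indicator b))
  indicator-∧ false b = sym (ℤ.*-zeroˡ (indicator b))

  sublists-length : ∀ (xs : List A) → All (λ s → length s ≤ length xs) (sublists xs)
  sublists-length []       = z≤n ∷ []
  sublists-length (x ∷ xs) =
    All.++⁺ (All.map ℕ.m≤n⇒m≤1+n (sublists-length xs)) (All.map⁺ (All.map s≤s (sublists-length xs)))

  ∑-upTo-suc : ∀ K (f : ℕ → ℤ) → ∑ (upTo (suc K)) f ≡ f 0 + ∑ (upTo K) (f ∘ suc)
  ∑-upTo-suc K f =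
    cong (_+_ (f 0)) (trans (cong (λ js → ∑ js f) (sym (map-applyUpTo id suc K))) (∑-map suc (upTo K) f))

  ∑-upTo-δ : ∀ K k (f : ℕ → ℤ) → k < K → ∑ (upTo K) (λ j → f j * indicator (k ≡ᵇ j)) ≡ f k
  ∑-upTo-δ (suc K) zero f _ = begin
    ∑ (upTo (suc K)) (λ j → f j * indicator (0 ≡ᵇ j))
                                                       ≡⟨ ∑-upTo-suc K (λ j → f j * indicator (0 ≡ᵇ j)) ⟩
    f 0 * 1ℤ + ∑ (upTo K) (λ j → f (suc j) * 0ℤ)       ≡⟨ cong₂ _+_ (ℤ.*-identityʳ (f 0))
                                                                  (∑-cong (upTo K) (ℤ.*-zeroʳ ∘ f ∘ suc)) ⟩
    f 0 + ∑ (upTo K) (λ _ → 0ℤ)                        ≡⟨ cong (_+_ (f 0)) (∑-zero (upTo K)) ⟩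
    f 0 + 0ℤ                                           ≡⟨ ℤ.+-identityʳ (f 0) ⟩
    f 0                                                ∎
    where open ≡-Reasoning
  ∑-upTo-δ (suc K) (suc k) f (s≤s k<K) = begin
    ∑ (upTo (suc K)) (λ j → f j * indicator (suc k ≡ᵇ j))
                                                                  ≡⟨ ∑-upTo-suc K (λ j → f j * indicator (suc k ≡ᵇ j)) ⟩
    f 0 * 0ℤ + ∑ (upTo K) (λ j → f (suc j) * indicator (k ≡ᵇ j))  ≡⟨ cong₂ _+_ (ℤ.*-zeroʳ (f 0))
                                                                             (∑-upTo-δ K k (f ∘ suc) k<K) ⟩
    0ℤ + f (suc k)                                                ≡⟨ ℤ.+-identityˡ (f (suc k)) ⟩
    f (suc k)                                                     ∎
    where open ≡-Reasoning

  infix 4 _≡_mod_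
  record _≡_mod_ (a b : ℤ) (m : ℕ) : Set where
    constructor mod-divides
    field divides-difference : + m ∣ℤ a - b
  open _≡_mod_

  module _ {m : ℕ} where

    ≡-mod-reflexive : ∀ {a b} → a ≡ b → a ≡ b mod m
    ≡-mod-reflexive {a} refl = mod-divides (divides 0ℤ (ℤ.+-inverseʳ a))

    ≡-mod-refl : ∀ {a} → a ≡ a mod m
    ≡-mod-refl = ≡-mod-reflexive refl

    ≡-mod-sym : ∀ {a b} → a ≡ b mod m → b ≡ a mod m
    ≡-mod-sym {a} {b} (mod-divides m∣a-b) = mod-divides (subst (+ m ∣ℤ_) (negate a b) (∣m⇒∣-m m∣a-b))
      where
      negate : ∀ a b → - (a - b) ≡ b - a
      negate = solve-∀

    ≡-mod-trans : ∀ {a b c} → a ≡ b mod m → b ≡ c mod m → a ≡ c mod m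
    ≡-mod-trans {a} {b} {c} (mod-divides m∣a-b) (mod-divides m∣b-c) =
      mod-divides (subst (+ m ∣ℤ_) (telescope a b c) (∣m∣n⇒∣m+n m∣a-b m∣b-c))
      where
      telescope : ∀ a b c → (a - b) + (b - c) ≡ a - c
      telescope = solve-∀

    +-cong-mod : ∀ {a b c d} → a ≡ b mod m → c ≡ d mod m → a + c ≡ b + d mod m
    +-cong-mod {a} {b} {c} {d} (mod-divides m∣a-b) (mod-divides m∣c-d) =
      mod-divides (subst (+ m ∣ℤ_) (regroup a b c d) (∣m∣n⇒∣m+n m∣a-b m∣c-d))
      where
      regroup : ∀ a b c d → (a - b) + (c - d) ≡ (a + c) - (b + d)
      regroup = solve-∀

    neg-cong-mod : ∀ {a b} → a ≡ b mod m → - a ≡ - b mod m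
    neg-cong-mod {a} {b} (mod-divides m∣a-b) =
      mod-divides (subst (+ m ∣ℤ_) (regroup a b) (∣m⇒∣-m m∣a-b))
      where
      regroup : ∀ a b → - (a - b) ≡ - a - - b
      regroup = solve-∀

    -‿cong-mod : ∀ {a b c d} → a ≡ b mod m → c ≡ d mod m → a - c ≡ b - d mod m
    -‿cong-mod a≡b c≡d = +-cong-mod a≡b (neg-cong-mod c≡d)

    *-cong-mod : ∀ {a b c d} → a ≡ b mod m → c ≡ d mod m → a * c ≡ b * d mod m
    *-cong-mod {a} {b} {c} {d} (mod-divides m∣a-b) (mod-divides m∣c-d) =
      mod-divides (subst (+ m ∣ℤ_) (regroup a b c d)
                         (∣m∣n⇒∣m+n (∣m⇒∣m*n c m∣a-b) (∣n⇒∣m*n b m∣c-d)))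
      where
      regroup : ∀ a b c d → (a - b) * c + b * (c - d) ≡ a * c - b * d
      regroup = solve-∀

    *-congˡ-mod : ∀ a {b c} → b ≡ c mod m → a * b ≡ a * c mod m
    *-congˡ-mod a = *-cong-mod (≡-mod-refl {a})

    *-congʳ-mod : ∀ a {b c} → b ≡ c mod m → b * a ≡ c * a mod m
    *-congʳ-mod a b≡c = *-cong-mod b≡c (≡-mod-refl {a})

    ^-cong-mod : ∀ {a b} n → a ≡ b mod m → a ^ n ≡ b ^ n mod m
    ^-cong-mod zero    a≡b = ≡-mod-refl
    ^-cong-mod (suc n) a≡b = *-cong-mod a≡b (^-cong-mod n a≡b)

    ∣⇒≡0-mod : ∀ {a} → + m ∣ℤ a → a ≡ 0ℤ mod m
    ∣⇒≡0-mod {a} m∣a = mod-divides (subst (+ m ∣ℤ_) (sym (ℤ.+-identityʳ a)) m∣a)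

    ≡0-mod⇒∣ : ∀ {a} → a ≡ 0ℤ mod m → + m ∣ℤ a
    ≡0-mod⇒∣ {a} (mod-divides m∣a-0) = subst (+ m ∣ℤ_) (ℤ.+-identityʳ a) m∣a-0

    ∑-cong-mod : ∀ {S : List B} {f g} → All (λ b → f b ≡ g b mod m) S → ∑ S f ≡ ∑ S g mod m
    ∑-cong-mod []            = ≡-mod-refl
    ∑-cong-mod (fb≡gb ∷ f≡g) = +-cong-mod fb≡gb (∑-cong-mod f≡g)

  ≡-mod-setoid : ℕ → Setoid 0ℓ 0ℓ
  ≡-mod-setoid m = record
    { Carrier       = ℤ
    ; _≈_           = _≡_mod m
    ; isEquivalence = record { refl = ≡-mod-refl ; sym = ≡-mod-sym ; trans = ≡-mod-trans }
    }

  ∑-upTo-4≡0⇒∣ : ∀ m (N : ℕ → ℤ) → ∑ (upTo 4) (λ j → -1ℤ ^ j * N j) ≡ 0ℤ mod m →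
                 + m ∣ℤ - N 0 + N 1 - N 2 + N 3
  ∑-upTo-4≡0⇒∣ m N ∑≡0 =
    subst (+ m ∣ℤ_) (negate (N 0) (N 1) (N 2) (N 3)) (∣m⇒∣-m (≡0-mod⇒∣ ∑≡0))
    where
    negate : ∀ a b c d → - (1ℤ * a + (-1ℤ * b + (1ℤ * c + (-1ℤ * d + 0ℤ)))) ≡ - a + b - c + d
    negate = solve-∀

  -- Fermat's little theorem

  n∣n! : ∀ n → .{{NonZero n}} → n ∣ℕ n !
  n∣n! (suc n) = m∣m*n (n !)

  ×≡* : ∀ n a → n × a ≡ + n * a
  ×≡* zero    a = sym (ℤ.*-zeroˡ a)
  ×≡* (suc n) a = trans (cong (_+_ a) (×≡* n a)) (sym (ℤ.suc-* (+ n) a))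

  ^ᴿ≡^ : ∀ a n → a Semiring.^ n ≡ a ^ n
  ^ᴿ≡^ a zero    = refl
  ^ᴿ≡^ a (suc n) = cong (a *_) (^ᴿ≡^ a n)

  ∣-sum : ∀ {d n} (t : Fin n → ℤ) → (∀ i → d ∣ℤ t i) → d ∣ℤ sum t
  ∣-sum {n = zero}  t d∣t = divides 0ℤ refl
  ∣-sum {n = suc n} t d∣t = ∣m∣n⇒∣m+n (d∣t Fin.zero) (∣-sum (t ∘ Fin.suc) (d∣t ∘ Fin.suc))

  ∣⇒∣^ : ∀ {d t} n → 0 < n → d ∣ℤ t → d ∣ℤ t ^ n
  ∣⇒∣^ {t = t} (suc n) _ d∣t = ∣m⇒∣m*n (t ^ n) d∣t

  euclidsLemma-ℤ : ∀ a b {p} → Prime p → + p ∣ℤ a * b → + p ∣ℤ a ⊎ + p ∣ℤ b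
  euclidsLemma-ℤ a b {p} p-prime p∣ab
    with euclidsLemma (ℤ.∣ a ∣) (ℤ.∣ b ∣) p-prime (subst (p ∣ℕ_) (ℤ.abs-* a b) (∣⇒∣ᵤ p∣ab))
  ... | inj₁ p∣a = inj₁ (∣ᵤ⇒∣ p∣a)
  ... | inj₂ p∣b = inj₂ (∣ᵤ⇒∣ p∣b)

  χ : ℕ → ℤ → ℤ
  χ q t = 1ℤ - t ^ q

  module _ {q : ℕ} (p-prime : Prime (suc q)) where

    private
      p : ℕ
      p = suc q

    prime∤! : ∀ {n} → n < p → p ∤ n !
    prime∤! {zero}  _   p∣1 = ℕ.nonTrivial⇒≢1 {{prime⇒nonTrivial p-prime}} (∣1⇒≡1 p∣1)
    prime∤! {suc n} n<p p∣n! with euclidsLemma (suc n) (n !) p-prime p∣n!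
    ... | inj₁ p∣n  = ℕ.<⇒≱ n<p (∣⇒≤ p∣n)
    ... | inj₂ p∣n! = prime∤! (ℕ.<-trans (ℕ.n<1+n n) n<p) p∣n!

    prime∣pCk : ∀ {k} → 0 < k → k < p → p ∣ℕ p C k
    prime∣pCk {k} 0<k k<p with euclidsLemma (p C k) (k ! ℕ.* (p ℕ.∸ k) !) p-prime p∣C*d
      where
      C*d≡p! : (p C k) ℕ.* (k ! ℕ.* (p ℕ.∸ k) !) ≡ p !
      C*d≡p! = trans (cong (ℕ._* (k ! ℕ.* (p ℕ.∸ k) !)) (nCk≡n!/k![n-k]! (ℕ.<⇒≤ k<p)))
                     (m/n*n≡m {{ℕ._!*_!≢0 k (p ℕ.∸ k)}} (k![n∸k]!∣n! (ℕ.<⇒≤ k<p)))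
      p∣C*d : p ∣ℕ (p C k) ℕ.* (k ! ℕ.* (p ℕ.∸ k) !)
      p∣C*d = subst (p ∣ℕ_) (sym C*d≡p!) (n∣n! p {{prime⇒nonZero p-prime}})
    ... | inj₁ p∣C = p∣C
    ... | inj₂ p∣d with euclidsLemma (k !) ((p ℕ.∸ k) !) p-prime p∣d
    ...   | inj₁ p∣k!     = contradiction p∣k! (prime∤! k<p)
    ...   | inj₂ p∣[p∸k]! = contradiction p∣[p∸k]! (prime∤! (ℕ.∸-monoʳ-< 0<k (ℕ.<⇒≤ k<p)))

    frobenius-1+ : ∀ x → (1ℤ + x) ^ p ≡ 1ℤ + x ^ p mod p
    frobenius-1+ x = begin
      (1ℤ + x) ^ p                                      ≡⟨ ^ᴿ≡^ (1ℤ + x) p ⟨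
      (1ℤ + x) Semiring.^ p                             ≡⟨ theorem p 1ℤ x ⟩
      t Fin.zero + sum (t ∘ Fin.suc)
        ≡⟨ cong (_+_ (t Fin.zero)) (sum-init-last (t ∘ Fin.suc)) ⟩
      t Fin.zero + (sum middle + t (Fin.suc (fromℕ q)))
        ≈⟨ +-cong-mod (≡-mod-reflexive first) (+-cong-mod (∣⇒≡0-mod p∣middle) (≡-mod-reflexive last)) ⟩
      x ^ p + (0ℤ + 1ℤ)                                 ≡⟨ ℤ.+-comm (x ^ p) 1ℤ ⟩
      1ℤ + x ^ p                                        ∎
      where
      open SetoidReasoning (≡-mod-setoid p)
      monomial : Fin (suc p) → ℤ
      monomial k = 1ℤ Semiring.^ toℕ k * x Semiring.^ (p ℕ.∸ toℕ k)
      t : Fin (suc p) → ℤ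
      t k = (p C toℕ k) × monomial k
      middle : Fin q → ℤ
      middle i = t (Fin.suc (inject₁ i))
      first : t Fin.zero ≡ x ^ p
      first = trans (ℤ.+-identityʳ _) (trans (ℤ.*-identityˡ _) (^ᴿ≡^ x p))
      last : t (Fin.suc (fromℕ q)) ≡ 1ℤ
      last rewrite toℕ-fromℕ q | nCn≡1 p | ℕ.n∸n≡0 q =
        trans (ℤ.+-identityʳ _) (trans (ℤ.*-identityʳ _) (trans (^ᴿ≡^ 1ℤ p) (ℤ.^-zeroˡ p)))
      p∣term : ∀ k → p ∣ℕ p C toℕ k → + p ∣ℤ t k
      p∣term k p∣C = subst (+ p ∣ℤ_) (sym (×≡* (p C toℕ k) (monomial k)))
                           (∣m⇒∣m*n (monomial k) (∣ᵤ⇒∣ {+ p} {+ (p C toℕ k)} p∣C))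
      p∣middle : + p ∣ℤ sum middle
      p∣middle = ∣-sum middle λ i → p∣term (Fin.suc (inject₁ i))
        (prime∣pCk ℕ.z<s (ℕ.s<s (subst (ℕ._< q) (sym (toℕ-inject₁ i)) (toℕ<n i))))

    fermat-ℕ : ∀ n → (+ n) ^ p ≡ + n mod p
    fermat-ℕ zero    = ≡-mod-reflexive (ℤ.*-zeroˡ ((+ 0) ^ q))
    fermat-ℕ (suc n) = ≡-mod-trans (frobenius-1+ (+ n)) (+-cong-mod (≡-mod-refl {a = 1ℤ}) (fermat-ℕ n))

    fermat : ∀ x → x ^ p ≡ x mod p
    fermat x = begin
      x ^ p     ≈⟨ ^-cong-mod p x≡r ⟩
      (+ r) ^ p ≈⟨ fermat-ℕ r ⟩
      + r       ≈⟨ x≡r ⟨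
      x         ∎
      where
      open SetoidReasoning (≡-mod-setoid p)
      r : ℕ
      r = x % + p
      x≡r : x ≡ + r mod p
      x≡r = mod-divides (divides (x / + p) (trans (cong (_- + r) (a≡a%n+[a/n]*n x (+ p))) (cancel (+ r) _)))
        where
        cancel : ∀ a b → a + b - a ≡ b
        cancel = solve-∀

    χ-∣ : ∀ {t} → p ∣ℕ ℤ.∣ t ∣ → χ q t ≡ 1ℤ mod p
    χ-∣ p∣t = -‿cong-mod (≡-mod-refl {a = 1ℤ}) (∣⇒≡0-mod (∣⇒∣^ q 0<q (∣ᵤ⇒∣ p∣t)))
      where
      0<q : 0 < q
      0<q = ℕ.s<s⁻¹ (ℕ.nonTrivial⇒n>1 p {{prime⇒nonTrivial p-prime}})

    χ-∤ : ∀ {t} → p ∤ ℤ.∣ t ∣ → χ q t ≡ 0ℤ mod p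
    χ-∤ {t} p∤t = [ (λ p∣t → contradiction (∣⇒∣ᵤ p∣t) p∤t)
                  , (λ p∣t^q-1 → -‿cong-mod (≡-mod-refl {a = 1ℤ}) (mod-divides {t ^ q} {1ℤ} p∣t^q-1))
                  ]′ (euclidsLemma-ℤ t (t ^ q - 1ℤ) p-prime p∣t*[t^q-1])
      where
      factor : ∀ t a → t * (a - 1ℤ) ≡ t * a - t
      factor = solve-∀
      p∣t*[t^q-1] : + p ∣ℤ t * (t ^ q - 1ℤ)
      p∣t*[t^q-1] = subst (+ p ∣ℤ_) (sym (factor t (t ^ q))) (divides-difference (fermat t))

  -1^odd-prime : ∀ {p} → Prime p → p ≢ 2 → -1ℤ ^ p ≡ -1ℤ
  -1^odd-prime {p} p-prime p≢2 with p ℕ.% 2 | m%n<n p 2 | m≡m%n+[m/n]*n p 2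
  ... | zero | _ | p≡[p/2]*2 with prime⇒irreducible p-prime (ℕ∣.divides (p ℕ./ 2) p≡[p/2]*2)
  ...   | inj₁ ()
  ...   | inj₂ 2≡p = contradiction (sym 2≡p) p≢2
  -1^odd-prime {p} p-prime p≢2 | suc zero | _ | p≡1+[p/2]*2 = begin
    -1ℤ ^ p                        ≡⟨ cong (-1ℤ ^_) p≡1+[p/2]*2 ⟩
    -1ℤ * -1ℤ ^ (p ℕ./ 2 ℕ.* 2)    ≡⟨ cong (λ n → -1ℤ * -1ℤ ^ n) (ℕ.*-comm (p ℕ./ 2) 2) ⟩
    -1ℤ * -1ℤ ^ (2 ℕ.* (p ℕ./ 2))  ≡⟨ cong (-1ℤ *_) (ℤ.^-*-assoc -1ℤ 2 (p ℕ./ 2)) ⟨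
    -1ℤ * 1ℤ ^ (p ℕ./ 2)           ≡⟨ cong (-1ℤ *_) (ℤ.^-zeroˡ (p ℕ./ 2)) ⟩
    -1ℤ                            ∎
    where open ≡-Reasoning
  -1^odd-prime {p} p-prime p≢2 | suc (suc _) | s≤s (s≤s ()) | _

  -- Finite differences of functions of a list

  Δ : A → (List A → ℤ) → List A → ℤ
  Δ x F s = F (x ∷ s) - F s

  data Degree≤ {A : Set} : ℕ → (List A → ℤ) → Set where
    Δ≡0       : (∀ x s → Δ x F s ≡ 0ℤ) → Degree≤ zero F
    Δ-degree≤ : (∀ x → Degree≤ d (Δ x F)) → Degree≤ (suc d) F

  module _ {A : Set} (x : A) (F G : List A → ℤ) (s : List A) where

    Δ-+ : Δ x (λ s → F s + G s) s ≡ Δ x F s + Δ x G s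
    Δ-+ = lemma (F (x ∷ s)) (G (x ∷ s)) (F s) (G s)
      where
      lemma : ∀ a b c d → (a + b) - (c + d) ≡ (a - c) + (b - d)
      lemma = solve-∀

    Δ-- : Δ x (λ s → F s - G s) s ≡ Δ x F s - Δ x G s
    Δ-- = lemma (F (x ∷ s)) (G (x ∷ s)) (F s) (G s)
      where
      lemma : ∀ a b c d → (a - b) - (c - d) ≡ (a - c) - (b - d)
      lemma = solve-∀

    Δ-* : Δ x (λ s → F s * G s) s ≡ Δ x F s * G (x ∷ s) + F s * Δ x G s
    Δ-* = lemma (F (x ∷ s)) (G (x ∷ s)) (F s) (G s)
      where
      lemma : ∀ a b c d → a * b - c * d ≡ (a - c) * b + c * (b - d)
      lemma = solve-∀

  Degree≤-cong : (∀ s → F s ≡ G s) → Degree≤ d F → Degree≤ d G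
  Degree≤-cong F≗G (Δ≡0 ΔF≡0) =
    Δ≡0 (λ x s → trans (cong₂ _-_ (sym (F≗G (x ∷ s))) (sym (F≗G s))) (ΔF≡0 x s))
  Degree≤-cong F≗G (Δ-degree≤ ΔF) =
    Δ-degree≤ (λ x → Degree≤-cong (λ s → cong₂ _-_ (F≗G (x ∷ s)) (F≗G s)) (ΔF x))

  Degree≤-const : ∀ d c → Degree≤ d (λ (_ : List A) → c)
  Degree≤-const zero    c = Δ≡0 (λ _ _ → ℤ.+-inverseʳ c)
  Degree≤-const (suc d) c =
    Δ-degree≤ (λ _ → Degree≤-cong (λ _ → sym (ℤ.+-inverseʳ c)) (Degree≤-const d 0ℤ))

  Degree≤-+ : Degree≤ d F → Degree≤ d G → Degree≤ d (λ s → F s + G s)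
  Degree≤-+ {F = F} {G = G} (Δ≡0 ΔF≡0) (Δ≡0 ΔG≡0) =
    Δ≡0 (λ x s → trans (Δ-+ x F G s) (cong₂ _+_ (ΔF≡0 x s) (ΔG≡0 x s)))
  Degree≤-+ {F = F} {G = G} (Δ-degree≤ ΔF) (Δ-degree≤ ΔG) =
    Δ-degree≤ (λ x → Degree≤-cong (λ s → sym (Δ-+ x F G s)) (Degree≤-+ (ΔF x) (ΔG x)))

  Degree≤-- : Degree≤ d F → Degree≤ d G → Degree≤ d (λ s → F s - G s)
  Degree≤-- {F = F} {G = G} (Δ≡0 ΔF≡0) (Δ≡0 ΔG≡0) =
    Δ≡0 (λ x s → trans (Δ-- x F G s) (cong₂ _-_ (ΔF≡0 x s) (ΔG≡0 x s)))
  Degree≤-- {F = F} {G = G} (Δ-degree≤ ΔF) (Δ-degree≤ ΔG) =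
    Δ-degree≤ (λ x → Degree≤-cong (λ s → sym (Δ-- x F G s)) (Degree≤-- (ΔF x) (ΔG x)))

  Degree≤-suc : Degree≤ d F → Degree≤ (suc d) F
  Degree≤-suc (Δ≡0 ΔF≡0)     =
    Δ-degree≤ (λ x → Degree≤-cong (λ s → sym (ΔF≡0 x s)) (Degree≤-const zero 0ℤ))
  Degree≤-suc (Δ-degree≤ ΔF) = Δ-degree≤ (λ x → Degree≤-suc (ΔF x))

  Degree≤-Δ : ∀ x → Degree≤ d F → Degree≤ d (Δ x F)
  Degree≤-Δ x (Δ≡0 ΔF≡0)     = Degree≤-cong (λ s → sym (ΔF≡0 x s)) (Degree≤-const zero 0ℤ)
  Degree≤-Δ x (Δ-degree≤ ΔF) = Degree≤-suc (ΔF x)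

  Degree≤-shift : ∀ x → Degree≤ d F → Degree≤ d (λ s → F (x ∷ s))
  Degree≤-shift {F = F} x hF =
    Degree≤-cong (λ s → telescope (F s) (F (x ∷ s))) (Degree≤-+ hF (Degree≤-Δ x hF))
    where
    telescope : ∀ a b → a + (b - a) ≡ b
    telescope = solve-∀

  Degree≤-* : Degree≤ d F → Degree≤ e G → Degree≤ (d ℕ.+ e) (λ s → F s * G s)
  Degree≤-* {F = F} {G = G} (Δ≡0 ΔF≡0) (Δ≡0 ΔG≡0) = Δ≡0 λ x s → begin
    Δ x (λ s → F s * G s) s
      ≡⟨ Δ-* x F G s ⟩
    Δ x F s * G (x ∷ s) + F s * Δ x G s
      ≡⟨ cong₂ (λ a b → a * G (x ∷ s) + F s * b) (ΔF≡0 x s) (ΔG≡0 x s) ⟩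
    0ℤ * G (x ∷ s) + F s * 0ℤ
      ≡⟨ cong₂ _+_ (ℤ.*-zeroˡ (G (x ∷ s))) (ℤ.*-zeroʳ (F s)) ⟩
    0ℤ ∎
    where open ≡-Reasoning
  Degree≤-* {F = F} {G = G} (Δ-degree≤ ΔF) hG@(Δ≡0 ΔG≡0) = Δ-degree≤ λ x →
    Degree≤-cong (only-left x) (Degree≤-* (ΔF x) (Degree≤-shift x hG))
    where
    only-left : ∀ x s → Δ x F s * G (x ∷ s) ≡ Δ x (λ s → F s * G s) s
    only-left x s = sym (trans (Δ-* x F G s)
      (trans (cong (λ b → Δ x F s * G (x ∷ s) + F s * b) (ΔG≡0 x s))
             (trans (cong (_+_ (Δ x F s * G (x ∷ s))) (ℤ.*-zeroʳ (F s))) (ℤ.+-identityʳ _))))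
  Degree≤-* {F = F} {G = G} hF@(Δ≡0 ΔF≡0) (Δ-degree≤ ΔG) = Δ-degree≤ λ x →
    Degree≤-cong (only-right x) (Degree≤-* hF (ΔG x))
    where
    only-right : ∀ x s → F s * Δ x G s ≡ Δ x (λ s → F s * G s) s
    only-right x s = sym (trans (Δ-* x F G s)
      (trans (cong (λ a → a * G (x ∷ s) + F s * Δ x G s) (ΔF≡0 x s))
             (trans (cong (_+ F s * Δ x G s) (ℤ.*-zeroˡ (G (x ∷ s)))) (ℤ.+-identityˡ _))))
  Degree≤-* {F = F} {G = G} hF@(Δ-degree≤ {d} ΔF) hG@(Δ-degree≤ {e} ΔG) = Δ-degree≤ λ x →
    Degree≤-cong (λ s → sym (Δ-* x F G s))
      (Degree≤-+ (Degree≤-* (ΔF x) (Degree≤-shift x hG))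
                 (subst (λ k → Degree≤ k (λ s → F s * Δ x G s)) (sym (ℕ.+-suc d e))
                        (Degree≤-* hF (ΔG x))))

  Degree≤-^ : ∀ n → Degree≤ d F → Degree≤ (n ℕ.* d) (λ s → F s ^ n)
  Degree≤-^ zero    hF = Degree≤-const zero 1ℤ
  Degree≤-^ (suc n) hF = Degree≤-* hF (Degree≤-^ n hF)

  Degree≤-additive : ∀ (F : List A → ℤ) (c : A → ℤ) → (∀ x s → F (x ∷ s) ≡ c x + F s) → Degree≤ 1 F
  Degree≤-additive F c F-∷ = Δ-degree≤ λ x →
    Degree≤-cong (λ s → sym (trans (cong (_- F s) (F-∷ x s)) (cancel (c x) (F s))))
                 (Degree≤-const zero (c x))
    where
    cancel : ∀ a b → a + b - b ≡ a
    cancel = solve-∀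

  Degree≤-χ : ∀ q {L : List A → ℤ} → Degree≤ 1 L → Degree≤ q (λ s → χ q (L s))
  Degree≤-χ q {L} hL =
    Degree≤-- (Degree≤-const q 1ℤ)
              (subst (λ d → Degree≤ d (λ s → L s ^ q)) (ℕ.*-identityʳ q) (Degree≤-^ q hL))

  alternatingSum : List A → (List A → ℤ) → ℤ
  alternatingSum xs F = ∑ (sublists xs) (λ s → -1ℤ ^ length s * F s)

  alternatingSum-∷ : ∀ x (xs : List A) F → alternatingSum (x ∷ xs) F ≡ -1ℤ * alternatingSum xs (Δ x F)
  alternatingSum-∷ {A = A} x xs F = begin
    ∑ (S ++ map (x ∷_) S) term                     ≡⟨ ∑-++ S (map (x ∷_) S) term ⟩
    ∑ S term + ∑ (map (x ∷_) S) term               ≡⟨ cong (_+_ (∑ S term)) (∑-map (x ∷_) S term) ⟩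
    ∑ S term + ∑ S (term ∘ (x ∷_))                 ≡⟨ ∑-+ S term (term ∘ (x ∷_)) ⟨
    ∑ S (λ s → term s + term (x ∷ s))              ≡⟨ ∑-cong S pair ⟩
    ∑ S (λ s → -1ℤ * (-1ℤ ^ length s * Δ x F s))   ≡⟨ ∑-* S -1ℤ _ ⟩
    -1ℤ * alternatingSum xs (Δ x F)                ∎
    where
    open ≡-Reasoning
    S : List (List A)
    S = sublists xs
    term : List A → ℤ
    term s = -1ℤ ^ length s * F s
    pair : ∀ s → term s + term (x ∷ s) ≡ -1ℤ * (-1ℤ ^ length s * Δ x F s)
    pair s = lemma (-1ℤ ^ length s) (F s) (F (x ∷ s))
      where
      lemma : ∀ σ a b → σ * a + -1ℤ * σ * b ≡ -1ℤ * (σ * (b - a))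
      lemma = solve-∀

  alternatingSum-zero : ∀ (xs : List A) → (∀ s → F s ≡ 0ℤ) → alternatingSum xs F ≡ 0ℤ
  alternatingSum-zero {F = F} xs F≗0 = trans (∑-cong (sublists xs) signed-zero) (∑-zero (sublists xs))
    where
    signed-zero : ∀ s → -1ℤ ^ length s * F s ≡ 0ℤ
    signed-zero s = trans (cong (_*_ (-1ℤ ^ length s)) (F≗0 s)) (ℤ.*-zeroʳ (-1ℤ ^ length s))

  alternatingSum-vanishes : ∀ (xs : List A) → Degree≤ d F → d < length xs → alternatingSum xs F ≡ 0ℤ
  alternatingSum-vanishes {F = F} (x ∷ xs) hF (s≤s d≤|xs|) =
    trans (alternatingSum-∷ x xs F) (trans (cong (_*_ -1ℤ) (vanishes-Δ hF d≤|xs|)) (ℤ.*-zeroʳ -1ℤ))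
    where
    vanishes-Δ : Degree≤ d F → d ℕ.≤ length xs → alternatingSum xs (Δ x F) ≡ 0ℤ
    vanishes-Δ (Δ≡0 ΔF≡0)     _       = alternatingSum-zero xs (ΔF≡0 x)
    vanishes-Δ (Δ-degree≤ ΔF) d<|xs| = alternatingSum-vanishes xs (ΔF x) d<|xs|

  -- Counting subsets with sum ≡ (0,0) modulo an odd prime

  module _ {q : ℕ} (p-prime : Prime (suc q)) (p≢2 : suc q ≢ 2) where

    private
      p : ℕ
      p = suc q

    -1^[k*p] : ∀ k → -1ℤ ^ (k ℕ.* p) ≡ -1ℤ ^ k
    -1^[k*p] k = begin
      -1ℤ ^ (k ℕ.* p)   ≡⟨ cong (-1ℤ ^_) (ℕ.*-comm k p) ⟩
      -1ℤ ^ (p ℕ.* k)   ≡⟨ ℤ.^-*-assoc -1ℤ p k ⟨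
      (-1ℤ ^ p) ^ k     ≡⟨ cong (_^ k) (-1^odd-prime p-prime p≢2) ⟩
      -1ℤ ^ k           ∎
      where open ≡-Reasoning

    -- Stated with does (_ ≟ _), which is definitionally _≡ᵇ_, so that dec-true and dec-false apply.
    ≡ᵇ-*-cancelʳ : ∀ k j → does (k ℕ.* p ℕ.≟ j ℕ.* p) ≡ does (k ℕ.≟ j)
    ≡ᵇ-*-cancelʳ k j with k ℕ.≟ j
    ... | yes refl = trans (dec-true (k ℕ.* p ℕ.≟ k ℕ.* p) refl) (sym (dec-true (k ℕ.≟ k) refl))
    ... | no k≢j   = trans (dec-false (k ℕ.* p ℕ.≟ j ℕ.* p) (k≢j ∘ ℕ.*-cancelʳ-≡ k j p))
                           (sym (dec-false (k ℕ.≟ j) k≢j))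

    signed-χ : ∀ K m → m < K ℕ.* p →
               -1ℤ ^ m * χ q (+ m) ≡ ∑ (upTo K) (λ j → -1ℤ ^ j * indicator (m ≡ᵇ j ℕ.* p)) mod p
    signed-χ K m m<Kp with p ℕ∣.∣? m
    ... | no p∤m = begin
      -1ℤ ^ m * χ q (+ m)
        ≈⟨ *-congˡ-mod (-1ℤ ^ m) (χ-∤ p-prime {+ m} p∤m) ⟩
      -1ℤ ^ m * 0ℤ                                            ≡⟨ ℤ.*-zeroʳ (-1ℤ ^ m) ⟩
      0ℤ                                                      ≡⟨ ∑-zero (upTo K) ⟨
      ∑ (upTo K) (λ _ → 0ℤ)                                   ≡⟨ ∑-cong (upTo K) no-term ⟨
      ∑ (upTo K) (λ j → -1ℤ ^ j * indicator (m ≡ᵇ j ℕ.* p))   ∎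
      where
      open SetoidReasoning (≡-mod-setoid p)
      no-term : ∀ j → -1ℤ ^ j * indicator (m ≡ᵇ j ℕ.* p) ≡ 0ℤ
      no-term j rewrite dec-false (m ℕ.≟ j ℕ.* p) (λ m≡jp → p∤m (ℕ∣.divides j m≡jp)) =
        ℤ.*-zeroʳ (-1ℤ ^ j)
    ... | yes (ℕ∣.divides k refl) = begin
      -1ℤ ^ (k ℕ.* p) * χ q (+ (k ℕ.* p))
        ≈⟨ *-congˡ-mod (-1ℤ ^ (k ℕ.* p)) (χ-∣ p-prime {+ (k ℕ.* p)} (ℕ∣.divides k refl)) ⟩
      -1ℤ ^ (k ℕ.* p) * 1ℤ                 ≡⟨ trans (ℤ.*-identityʳ _) (-1^[k*p] k) ⟩
      -1ℤ ^ k                              ≡⟨ ∑-upTo-δ K k (-1ℤ ^_) (ℕ.*-cancelʳ-< p k K m<Kp) ⟨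
      ∑ (upTo K) (λ j → -1ℤ ^ j * indicator (k ≡ᵇ j))
        ≡⟨ ∑-cong (upTo K) (λ j → cong (λ b → -1ℤ ^ j * indicator b) (≡ᵇ-*-cancelʳ k j)) ⟨
      ∑ (upTo K) (λ j → -1ℤ ^ j * indicator (k ℕ.* p ≡ᵇ j ℕ.* p)) ∎
      where open SetoidReasoning (≡-mod-setoid p)

    χ-sumDivisible : ∀ s → χ q (proj₁ (sumPts s)) * χ q (proj₂ (sumPts s))
                         ≡ indicator (sumDivisible? p s) mod p
    χ-sumDivisible s with sumPts s
    ... | (a , b) with p ℕ∣.∣? ℤ.∣ a ∣ | p ℕ∣.∣? ℤ.∣ b ∣
    ... | yes p∣a | yes p∣b = *-cong-mod (χ-∣ p-prime {a} p∣a) (χ-∣ p-prime {b} p∣b)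
    ... | yes _   | no p∤b  =
      ≡-mod-trans (*-congˡ-mod (χ q a) (χ-∤ p-prime {b} p∤b)) (≡-mod-reflexive (ℤ.*-zeroʳ (χ q a)))
    ... | no p∤a  | _       =
      ≡-mod-trans (*-congʳ-mod (χ q b) (χ-∤ p-prime {a} p∤a)) (≡-mod-reflexive (ℤ.*-zeroˡ (χ q b)))

    Φ : ℕ → List Point → ℤ
    Φ c s = χ q (+ (c ℕ.+ length s)) * (χ q (proj₁ (sumPts s)) * χ q (proj₂ (sumPts s)))

    Degree≤-Φ : ∀ c → Degree≤ (q ℕ.+ (q ℕ.+ q)) (Φ c)
    Degree≤-Φ c = Degree≤-* (Degree≤-χ q size) (Degree≤-* (Degree≤-χ q Σx) (Degree≤-χ q Σy))
      where
      size : Degree≤ 1 (λ s → + (c ℕ.+ length s))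
      size = Degree≤-additive (λ s → + (c ℕ.+ length s)) (λ _ → 1ℤ)
                              (λ _ s → cong +_ (ℕ.+-suc c (length s)))
      Σx : Degree≤ 1 (λ s → proj₁ (sumPts s))
      Σx = Degree≤-additive (λ s → proj₁ (sumPts s)) proj₁ (λ _ _ → refl)
      Σy : Degree≤ 1 (λ s → proj₂ (sumPts s))
      Σy = Degree≤-additive (λ s → proj₂ (sumPts s)) proj₂ (λ _ _ → refl)

    signed-Φ : ∀ K c s → c ℕ.+ length s < K ℕ.* p →
               -1ℤ ^ (c ℕ.+ length s) * Φ c s
                 ≡ ∑ (upTo K) (λ j → -1ℤ ^ j * indicator ((c ℕ.+ length s ≡ᵇ j ℕ.* p) ∧ sumDivisible? p s))
                 mod p
    signed-Φ K c s m<Kp = begin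
      -1ℤ ^ m * (χ q (+ m) * χs)                    ≡⟨ ℤ.*-assoc (-1ℤ ^ m) (χ q (+ m)) χs ⟨
      -1ℤ ^ m * χ q (+ m) * χs                      ≈⟨ *-cong-mod (signed-χ K m m<Kp) (χ-sumDivisible s) ⟩
      ∑ (upTo K) size-term * indicator divisible            ≡⟨ ∑-*ʳ (upTo K) size-term _ ⟨
      ∑ (upTo K) (λ j → size-term j * indicator divisible)  ≡⟨ ∑-cong (upTo K) combine ⟩
      ∑ (upTo K) (λ j → -1ℤ ^ j * indicator ((m ≡ᵇ j ℕ.* p) ∧ divisible)) ∎
      where
      open SetoidReasoning (≡-mod-setoid p)
      m : ℕ
      m = c ℕ.+ length s
      divisible : Bool
      divisible = sumDivisible? p s
      χs : ℤ
      χs = χ q (proj₁ (sumPts s)) * χ q (proj₂ (sumPts s))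
      size-term : ℕ → ℤ
      size-term j = -1ℤ ^ j * indicator (m ≡ᵇ j ℕ.* p)
      combine : ∀ j → size-term j * indicator divisible ≡ -1ℤ ^ j * indicator ((m ≡ᵇ j ℕ.* p) ∧ divisible)
      combine j = trans (ℤ.*-assoc (-1ℤ ^ j) _ _)
                        (cong (_*_ (-1ℤ ^ j)) (sym (indicator-∧ (m ≡ᵇ j ℕ.* p) divisible)))

    alternating-count-congruence :
      ∀ K c (X : List Point) → q ℕ.+ (q ℕ.+ q) < length X → c ℕ.+ length X < K ℕ.* p →
      ∑ (upTo K) (λ j → -1ℤ ^ j *
                         + count (λ s → (c ℕ.+ length s ≡ᵇ j ℕ.* p) ∧ sumDivisible? p s) (sublists X))
        ≡ 0ℤ mod p
    alternating-count-congruence K c X 3q<|X| c+|X|<Kp = ≡-mod-sym (begin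
      0ℤ                                                    ≡⟨ signed-vanishes ⟨
      -1ℤ ^ c * alternatingSum X (Φ c)                      ≡⟨ ∑-* S (-1ℤ ^ c) _ ⟨
      ∑ S (λ s → -1ℤ ^ c * (-1ℤ ^ length s * Φ c s))        ≡⟨ ∑-cong S merge-signs ⟩
      ∑ S (λ s → -1ℤ ^ (c ℕ.+ length s) * Φ c s)            ≈⟨ ∑-cong-mod pointwise ⟩
      ∑ S (λ s → ∑ J (λ j → -1ℤ ^ j * indicator (P j s)))   ≡⟨ ∑-comm S J _ ⟩
      ∑ J (λ j → ∑ S (λ s → -1ℤ ^ j * indicator (P j s)))   ≡⟨ ∑-cong J counts ⟩
      ∑ J (λ j → -1ℤ ^ j * + count (P j) S)                 ∎)
      where
      open SetoidReasoning (≡-mod-setoid p)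
      S : List (List Point)
      S = sublists X
      J : List ℕ
      J = upTo K
      P : ℕ → List Point → Bool
      P j s = (c ℕ.+ length s ≡ᵇ j ℕ.* p) ∧ sumDivisible? p s
      signed-vanishes : -1ℤ ^ c * alternatingSum X (Φ c) ≡ 0ℤ
      signed-vanishes =
        trans (cong (_*_ (-1ℤ ^ c)) (alternatingSum-vanishes X (Degree≤-Φ c) 3q<|X|)) (ℤ.*-zeroʳ (-1ℤ ^ c))
      merge-signs : ∀ s → -1ℤ ^ c * (-1ℤ ^ length s * Φ c s) ≡ -1ℤ ^ (c ℕ.+ length s) * Φ c s
      merge-signs s =
        trans (sym (ℤ.*-assoc (-1ℤ ^ c) _ _)) (cong (_* Φ c s) (sym (ℤ.^-distribˡ-+-* -1ℤ c (length s))))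
      pointwise : All (λ s → -1ℤ ^ (c ℕ.+ length s) * Φ c s ≡ ∑ J (λ j → -1ℤ ^ j * indicator (P j s)) mod p)
                      S
      pointwise = All.map (λ {s} |s|≤|X| → signed-Φ K c s (ℕ.≤-<-trans (ℕ.+-monoʳ-≤ c |s|≤|X|) c+|X|<Kp))
                          (sublists-length X)
      counts : ∀ j → ∑ S (λ s → -1ℤ ^ j * indicator (P j s)) ≡ -1ℤ ^ j * + count (P j) S
      counts j = trans (∑-* S (-1ℤ ^ j) _) (cong (_*_ (-1ℤ ^ j)) (∑-count (P j) S))

    sumDivisible?-[] : sumDivisible? p [] ≡ true
    sumDivisible?-[] with p ℕ∣.∣? 0
    ... | yes _  = refl
    ... | no p∤0 = contradiction (p ℕ∣.∣0) p∤0

    +numSubsets-0 : ∀ X → + numSubsets p 0 X ≡ 1ℤ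
    +numSubsets-0 []       = cong (λ b → + (if b then 1 else 0)) sumDivisible?-[]
    +numSubsets-0 (x ∷ xs) = begin
      + count empty (S ++ map (x ∷_) S)           ≡⟨ ∑-count empty (S ++ map (x ∷_) S) ⟨
      ∑ (S ++ map (x ∷_) S) (indicator ∘ empty)   ≡⟨ ∑-++ S (map (x ∷_) S) (indicator ∘ empty) ⟩
      ∑ S (indicator ∘ empty) + ∑ (map (x ∷_) S) (indicator ∘ empty)
                                                  ≡⟨ cong (_+_ (∑ S (indicator ∘ empty)))
                                                          (trans (∑-map (x ∷_) S _) (∑-zero S)) ⟩
      ∑ S (indicator ∘ empty) + 0ℤ                ≡⟨ ℤ.+-identityʳ _ ⟩
      ∑ S (indicator ∘ empty)                     ≡⟨ ∑-count empty S ⟩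
      + count empty S                             ≡⟨ +numSubsets-0 xs ⟩
      1ℤ                                          ∎
      where
      open ≡-Reasoning
      S : List (List Point)
      S = sublists xs
      empty : List Point → Bool
      empty s = (length s ≡ᵇ 0) ∧ sumDivisible? p s

    module _ (X : List Point) (|X|≡4p∸3 : length X ≡ 4 ℕ.* p ℕ.∸ 3) where

      private
        4p≡4+4q : 4 ℕ.* p ≡ 4 ℕ.+ 4 ℕ.* q
        4p≡4+4q = ℕ.*-distribˡ-+ 4 1 q

        |X|≡1+4q : length X ≡ suc (4 ℕ.* q)
        |X|≡1+4q = trans |X|≡4p∸3 (cong (ℕ._∸ 3) 4p≡4+4q)

        3q<|X| : q ℕ.+ (q ℕ.+ q) < length X
        3q<|X| = subst (_ <_) (sym |X|≡1+4q)
                       (s≤s (ℕ.+-monoʳ-≤ q (ℕ.+-monoʳ-≤ q (ℕ.m≤m+n q (q ℕ.+ 0)))))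

        c+|X|<4p : ∀ c → c < 3 → c ℕ.+ length X < 4 ℕ.* p
        c+|X|<4p c c<3 =
          subst₂ _<_ (sym (trans (cong (c ℕ.+_) |X|≡1+4q) (ℕ.+-suc c (4 ℕ.* q)))) (sym 4p≡4+4q)
                     (ℕ.+-monoˡ-< (4 ℕ.* q) (s≤s c<3))

      kp-count-congruence :
        + p ∣ℤ - 1ℤ + + numSubsets p p X - + numSubsets p (2 ℕ.* p) X + + numSubsets p (3 ℕ.* p) X
      kp-count-congruence =
        subst (+ p ∣ℤ_)
          (cong₂ (λ a b → - a + b - + numSubsets p (2 ℕ.* p) X + + numSubsets p (3 ℕ.* p) X)
                 (+numSubsets-0 X) (cong (λ n → + numSubsets p n X) (ℕ.*-identityˡ p)))
          (∑-upTo-4≡0⇒∣ p (λ j → + numSubsets p (j ℕ.* p) X)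
            (alternating-count-congruence 4 0 X 3q<|X| (c+|X|<4p 0 (s≤s z≤n))))

      kp∸1-count-congruence :
        + p ∣ℤ + numSubsets p (p ℕ.∸ 1) X - + numSubsets p (2 ℕ.* p ℕ.∸ 1) X
               + + numSubsets p (3 ℕ.* p ℕ.∸ 1) X
      kp∸1-count-congruence =
        subst (+ p ∣ℤ_)
          (cong₂ (λ a b → - a + b - + numSubsets p (2 ℕ.* p ℕ.∸ 1) X + + numSubsets p (3 ℕ.* p ℕ.∸ 1) X)
                 (cong +_ (count-false (sublists X))) (cong (λ n → + numSubsets p n X) (ℕ.+-identityʳ q)))
          (∑-upTo-4≡0⇒∣ p (λ j → + count (λ s → (1 ℕ.+ length s ≡ᵇ j ℕ.* p) ∧ sumDivisible? p s) (sublists X))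
            (alternating-count-congruence 4 1 X 3q<|X| (c+|X|<4p 1 (s≤s (s≤s z≤n)))))

open import Data.Nat using (ℕ; _*_; _∸_)
open import Data.Nat.Primality using (Prime)
open import Data.Integer using (+_; -_; _+_; _-_)
open import Data.Integer.Divisibility using (_∣_)
open import Data.List using (List; length)
open import Data.List.Relation.Unary.Unique.Propositional using (Unique)
open import Relation.Binary.PropositionalEquality using (_≡_; _≢_)
open import Data.Product using (_×_)
open import Data.Nat using (zero; suc)
open import Data.Product using (_,_)
open import Data.Integer.Divisibility.Signed using (∣⇒∣ᵤ)

corollary5 : (p : ℕ) → Prime p → p ≢ 2 →
    (X : List Point) → Unique X → length X ≡ 4 * p ∸ 3 →
    ((+ p) ∣ (- (+ 1) + + numSubsets p p X - + numSubsets p (2 * p) X + + numSubsets p (3 * p) X))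
    × ((+ p) ∣ (+ numSubsets p (p ∸ 1) X - + numSubsets p (2 * p ∸ 1) X + + numSubsets p (3 * p ∸ 1) X))
corollary5 zero    ()
corollary5 (suc q) p-prime p≢2 X _ |X|≡4p∸3 =
  ∣⇒∣ᵤ (kp-count-congruence p-prime p≢2 X |X|≡4p∸3) , ∣⇒∣ᵤ (kp∸1-count-congruence p-prime p≢2 X |X|≡4p∸3)
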